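{- Let $\mathcal{C}=\mathsf{G3Int}+\{(id^*),(\neg_l),(\neg_r),(\supset^*_l),(lift)\}$, i.e. the calculus with rules $(id),(\bot_l),(\wedge_l),(\wedge_r),(\vee_l),(\vee_r),(\supset_r),(\supset_l),(ref),(tra),(id^*),(\neg_l),(\neg_r),(\supset^*_l),(lift)$, and let $\mathcal{C}^-$ be $\mathcal{C}$ without $(id),(\bot_l),(\supset_l),(ref),(tra)$. Then every labelled sequent derivable in $\mathcal{C}$ is derivable in $\mathcal{C}^-$; i.e. the rules $(id),(\bot_l),(\supset_l),(ref),(tra)$ are admissible in $\mathcal{C}^-$.
   Context: Formulas: $A::= p\mid \neg A\mid (A\wedge A)\mid(A\vee A)\mid(A\supset A)$, $p$ ranging over propositional variables; for a fixed propositional variable $p_0$, $\bot$ abbreviates $p_0\wedge\neg p_0$. Labelled sequents $\mathcal{R},\Gamma\Rightarrow\Delta$: $\mathcal{R}$ a multiset of relational atoms $w\le v$ ($w,v$ labels), $\Gamma,\Delta$ multisets of labelled formulas $w:A$; components may be empty. Rules: $(id)$: $\mathcal{R},w\le v,w:p,\Gamma\Rightarrow\Delta,v:p$; $(\bot_l)$: $\mathcal{R},w:\bot,\Gamma\Rightarrow\Delta$; $(\wedge_l)$: from $\mathcal{R},w:A,w:B,\Gamma\Rightarrow\Delta$ infer $\mathcal{R},w:A\wedge B,\Gamma\Rightarrow\Delta$; $(\wedge_r)$: from $\mathcal{R},\Gamma\Rightarrow\Delta,w:A$ and $\mathcal{R},\Gamma\Rightarrow\Delta,w:B$ infer $\mathcal{R},\Gamma\Rightarrow\Delta,w:A\wedge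 B$; $(\vee_l)$: from $\mathcal{R},w:A,\Gamma\Rightarrow\Delta$ and $\mathcal{R},w:B,\Gamma\Rightarrow\Delta$ infer $\mathcal{R},w:A\vee B,\Gamma\Rightarrow\Delta$; $(\vee_r)$: from $\mathcal{R},\Gamma\Rightarrow\Delta,w:A,w:B$ infer $\mathcal{R},\Gamma\Rightarrow\Delta,w:A\vee B$; $(\supset_r)$: from $\mathcal{R},w\le v,v:A,\Gamma\Rightarrow\Delta,v:B$ infer $\mathcal{R},\Gamma\Rightarrow\Delta,w:A\supset B$, $v$ not in the conclusion; $(\supset_l)$: from $\mathcal{R},w\le v,w:A\supset B,\Gamma\Rightarrow\Delta,v:A$ and $\mathcal{R},w\le v,w:A\supset B,v:B,\Gamma\Rightarrow\Delta$ infer $\mathcal{R},w\le v,w:A\supset B,\Gamma\Rightarrow\Delta$; $(ref)$: from $\mathcal{R},w\le w,\Gamma\Rightarrow\Delta$ infer $\mathcal{R},\Gamma\Rightarrow\Delta$; $(tra)$: from $\mathcal{R},w\le v,v\le u,w\le u,\Gamma\Rightarrow\Delta$ infer $\mathcal{R},w\le v,v\le u,\Gamma\Rightarrow\Delta$; $(id^*)$: $\mathcal{R},w:p,\Gamma\Rightarrow\Delta,w:p$; $(\neg_r)$: from $\mathcal{R},w\le v,v:A,\Gamma\Rightarrow\Delta$ infer $\mathcal{R},\Gamma\Rightarrow\Delta,w:\neg A$, $v$ not in the conclusion; $(\neg_l)$: from $\mathcal{R},w:\neg A,\Gamma\Rightarrow\Delta,w:A$ infer $\mathcal{R},w:\neg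 A,\Gamma\Rightarrow\Delta$; $(\supset^*_l)$: from $\mathcal{R},w:A\supset B,\Gamma\Rightarrow\Delta,w:A$ and $\mathcal{R},w:A\supset B,w:B,\Gamma\Rightarrow\Delta$ infer $\mathcal{R},w:A\supset B,\Gamma\Rightarrow\Delta$; $(lift)$: from $\mathcal{R},w\le u,w:A,u:A,\Gamma\Rightarrow\Delta$ infer $\mathcal{R},w\le u,w:A,\Gamma\Rightarrow\Delta$. -}

module Defs where

open import Data.Nat using (ℕ)
open import Data.Bool using (Bool; true; false)
open import Data.List using (List; []; _∷_; _++_; concatMap)
open import Data.List.Membership.Propositional using (_∈_)
open import Data.List.Relation.Binary.Permutation.Propositional using (_↭_)
open import Data.Product using (_×_; _,_)
open import Relation.Nullary using (¬_)
open import Relation.Binary.PropositionalEquality using (_≡_)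

Var : Set
Var = ℕ

Label : Set
Label = ℕ

infixr 6 _∧_
infixr 5 _∨_
infixr 4 _⊃_

data Formula : Set where
  var : Var → Formula
  ¬'  : Formula → Formula
  _∧_ : Formula → Formula → Formula
  _∨_ : Formula → Formula → Formula
  _⊃_ : Formula → Formula → Formula

p₀ : Var
p₀ = 0

⊥' : Formula
⊥' = var p₀ ∧ ¬' (var p₀)

record RelAtom : Set where
  constructor _≤'_
  field
    src : Label
    tgt : Label

record LFormula : Set where
  constructor _∶_
  field
    lab : Label
    fml : Formula

-- labelled sequent R, Γ ⇒ Δ ; multisets are modelled as lists modulo
-- permutation (see the exchange rule `perm` below).
infix 2 _∣_⇒_
infix 7 _≤'_
infix 3 _∶_

record Sequent : Set where
  constructor _∣_⇒_
  field
    rel : List RelAtom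
    ant : List LFormula
    suc : List LFormula

labelsR : List RelAtom → List Label
labelsR = concatMap (λ { (w ≤' v) → w ∷ v ∷ [] })

labelsF : List LFormula → List Label
labelsF = concatMap (λ { (w ∶ _) → w ∷ [] })

labels : Sequent → List Label
labels (R ∣ Γ ⇒ Δ) = labelsR R ++ labelsF Γ ++ labelsF Δ

Fresh : Label → Sequent → Set
Fresh v S = ¬ (v ∈ labels S)

-- The Bool index `full` selects the calculus:
--   full = true  : 𝒞  (all fifteen rules)
--   full = false : 𝒞⁻ (𝒞 without (id), (⊥l), (⊃l), (ref), (tra))
-- Principal formulas are placed at the head of the lists; since contexts
-- are multisets, the structural rule `perm` identifies sequents whose
-- components are permutations of each other.
data Der (full : Bool) : Sequent → Set where
  perm : ∀ {R R' Γ Γ' Δ Δ'} →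
    R ↭ R' → Γ ↭ Γ' → Δ ↭ Δ' →
    Der full (R ∣ Γ ⇒ Δ) → Der full (R' ∣ Γ' ⇒ Δ')
  id  : ∀ {R Γ Δ w v p} → full ≡ true →
    Der full ((w ≤' v) ∷ R ∣ (w ∶ var p) ∷ Γ ⇒ (v ∶ var p) ∷ Δ)
  ⊥l  : ∀ {R Γ Δ w} → full ≡ true →
    Der full (R ∣ (w ∶ ⊥') ∷ Γ ⇒ Δ)
  ∧l  : ∀ {R Γ Δ w A B} →
    Der full (R ∣ (w ∶ A) ∷ (w ∶ B) ∷ Γ ⇒ Δ) →
    Der full (R ∣ (w ∶ A ∧ B) ∷ Γ ⇒ Δ)
  ∧r  : ∀ {R Γ Δ w A B} →
    Der full (R ∣ Γ ⇒ (w ∶ A) ∷ Δ) →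
    Der full (R ∣ Γ ⇒ (w ∶ B) ∷ Δ) →
    Der full (R ∣ Γ ⇒ (w ∶ A ∧ B) ∷ Δ)
  ∨l  : ∀ {R Γ Δ w A B} →
    Der full (R ∣ (w ∶ A) ∷ Γ ⇒ Δ) →
    Der full (R ∣ (w ∶ B) ∷ Γ ⇒ Δ) →
    Der full (R ∣ (w ∶ A ∨ B) ∷ Γ ⇒ Δ)
  ∨r  : ∀ {R Γ Δ w A B} →
    Der full (R ∣ Γ ⇒ (w ∶ A) ∷ (w ∶ B) ∷ Δ) →
    Der full (R ∣ Γ ⇒ (w ∶ A ∨ B) ∷ Δ)
  ⊃r  : ∀ {R Γ Δ w v A B} →
    Fresh v (R ∣ Γ ⇒ (w ∶ A ⊃ B) ∷ Δ) →
    Der full ((w ≤' v) ∷ R ∣ (v ∶ A) ∷ Γ ⇒ (v ∶ B) ∷ Δ) →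
    Der full (R ∣ Γ ⇒ (w ∶ A ⊃ B) ∷ Δ)
  ⊃l  : ∀ {R Γ Δ w v A B} → full ≡ true →
    Der full ((w ≤' v) ∷ R ∣ (w ∶ A ⊃ B) ∷ Γ ⇒ (v ∶ A) ∷ Δ) →
    Der full ((w ≤' v) ∷ R ∣ (w ∶ A ⊃ B) ∷ (v ∶ B) ∷ Γ ⇒ Δ) →
    Der full ((w ≤' v) ∷ R ∣ (w ∶ A ⊃ B) ∷ Γ ⇒ Δ)
  ref : ∀ {R Γ Δ w} → full ≡ true →
    Der full ((w ≤' w) ∷ R ∣ Γ ⇒ Δ) →
    Der full (R ∣ Γ ⇒ Δ)
  tra : ∀ {R Γ Δ w v u} → full ≡ true →
    Der full ((w ≤' v) ∷ (v ≤' u) ∷ (w ≤' u) ∷ R ∣ Γ ⇒ Δ) →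
    Der full ((w ≤' v) ∷ (v ≤' u) ∷ R ∣ Γ ⇒ Δ)
  id*  : ∀ {R Γ Δ w p} →
    Der full (R ∣ (w ∶ var p) ∷ Γ ⇒ (w ∶ var p) ∷ Δ)
  ¬r   : ∀ {R Γ Δ w v A} →
    Fresh v (R ∣ Γ ⇒ (w ∶ ¬' A) ∷ Δ) →
    Der full ((w ≤' v) ∷ R ∣ (v ∶ A) ∷ Γ ⇒ Δ) →
    Der full (R ∣ Γ ⇒ (w ∶ ¬' A) ∷ Δ)
  ¬l   : ∀ {R Γ Δ w A} →
    Der full (R ∣ (w ∶ ¬' A) ∷ Γ ⇒ (w ∶ A) ∷ Δ) →
    Der full (R ∣ (w ∶ ¬' A) ∷ Γ ⇒ Δ)
  ⊃*l  : ∀ {R Γ Δ w A B} →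
    Der full (R ∣ (w ∶ A ⊃ B) ∷ Γ ⇒ (w ∶ A) ∷ Δ) →
    Der full (R ∣ (w ∶ A ⊃ B) ∷ (w ∶ B) ∷ Γ ⇒ Δ) →
    Der full (R ∣ (w ∶ A ⊃ B) ∷ Γ ⇒ Δ)
  lift : ∀ {R Γ Δ w u A} →
    Der full ((w ≤' u) ∷ R ∣ (w ∶ A) ∷ (u ∶ A) ∷ Γ ⇒ Δ) →
    Der full ((w ≤' u) ∷ R ∣ (w ∶ A) ∷ Γ ⇒ Δ)

Der𝒞 : Sequent → Set
Der𝒞 = Der true

Der𝒞⁻ : Sequent → Set
Der𝒞⁻ = Der false

{-# OPTIONS --safe #-}
module Submission where

-- A 𝒞-derivation is translated rule by rule, proving the stronger claim that every
-- weakening of a relabelling of its end-sequent is 𝒞⁻-derivable. In a weakening, a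
-- relational atom w ≤ v need only be realised by a ≤-path from f w to f v, which makes
-- (ref) and (tra) trivial; an antecedent formula need only be covered by the target
-- antecedent up to ∧/∨-decomposition; and the succedent may grow. Then (id) and (⊃l)
-- become (lift) along the path followed by (id*) and (⊃*l), (⊥l) becomes (∧l), (¬l)
-- and (id*), and eigenvariables are renamed to labels fresh for the target sequent.

open import Defs
open import Data.Nat using (suc)
open import Data.Nat.Properties using (1+n≰n; _≟_)
open import Data.Bool using (Bool)
open import Data.List using (List; []; _∷_; _++_; map)
open import Data.List.Properties using (map-id; map-cong-local; ++-identityʳ)
open import Data.List.Extrema.Nat using (max; xs≤max)
open import Data.List.Membership.Propositional using (_∈_)
open import Data.List.Membership.Propositional.Properties using (∈-∃++)
open import Data.List.Relation.Binary.Subset.Propositional using (_⊆_)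
open import Data.List.Relation.Unary.Any using (here; there)
open import Data.List.Relation.Unary.All as All using (All; []; _∷_)
open import Data.List.Relation.Unary.All.Properties using (¬Any⇒All¬; ++⁻; ++⁺; concat⁻; map⁻)
open import Data.List.Relation.Binary.Permutation.Propositional
  using (_↭_; ↭-refl; ↭-sym; ↭-trans; ↭-reflexive; prep; swap)
open import Data.List.Relation.Binary.Permutation.Propositional.Properties
  using (All-resp-↭; shift; map⁺; ++⁺ʳ)
open import Data.Product using (Σ; _×_; _,_)
open import Function using (_∘_)
open import Relation.Binary.Construct.Closure.ReflexiveTransitive as Star
  using (Star; ε; _◅_; _◅◅_)
open import Relation.Nullary using (yes; no; contradiction)
open import Relation.Binary.PropositionalEquality
  using (_≡_; _≢_; refl; sym; trans; cong; subst; subst₂)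

variable
  full : Bool
  p : Var
  a b u v v' w : Label
  A B C : Formula
  x y y' : LFormula
  α : RelAtom
  f g : Label → Label
  R R' R'' : List RelAtom
  Γ Γ' G Θ Δ Δ' : List LFormula
  S : Sequent

∈⇒↭∷ : ∀ {X : Set} {z : X} {zs} → z ∈ zs → Σ (List X) λ ys → zs ↭ z ∷ ys
∈⇒↭∷ {z = z} m with ys , zs , refl ← ∈-∃++ m = ys ++ zs , shift z ys zs

↭-ant : Γ ↭ Γ' → Der full (R ∣ Γ ⇒ Δ) → Der full (R ∣ Γ' ⇒ Δ)
↭-ant π = perm ↭-refl π ↭-refl

↭-suc : Δ ↭ Δ' → Der full (R ∣ Γ ⇒ Δ) → Der full (R ∣ Γ ⇒ Δ')
↭-suc τ = perm ↭-refl ↭-refl τ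

id*-∈ : (w ∶ var p) ∈ Γ → Der full (R ∣ Γ ⇒ (w ∶ var p) ∷ Δ)
id*-∈ m with _ , π ← ∈⇒↭∷ m = ↭-ant (↭-sym π) id*

¬l-∈ : (w ∶ ¬' A) ∈ Γ → Der full (R ∣ Γ ⇒ (w ∶ A) ∷ Δ) → Der full (R ∣ Γ ⇒ Δ)
¬l-∈ m d with _ , π ← ∈⇒↭∷ m = ↭-ant (↭-sym π) (¬l (↭-ant π d))

⊃*l-∈ : (w ∶ A ⊃ B) ∈ Γ → Der full (R ∣ Γ ⇒ (w ∶ A) ∷ Δ) → Der full (R ∣ (w ∶ B) ∷ Γ ⇒ Δ) →
        Der full (R ∣ Γ ⇒ Δ)
⊃*l-∈ m d e with _ , π ← ∈⇒↭∷ m =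
  ↭-ant (↭-sym π) (⊃*l (↭-ant π d) (↭-ant (↭-trans (prep _ π) (swap _ _ ↭-refl)) e))

lift-∈ : (w ≤' u) ∈ R → (w ∶ A) ∈ Γ → Der full (R ∣ (u ∶ A) ∷ Γ ⇒ Δ) → Der full (R ∣ Γ ⇒ Δ)
lift-∈ e m d with _ , ρ ← ∈⇒↭∷ e | _ , π ← ∈⇒↭∷ m =
  perm (↭-sym ρ) (↭-sym π) ↭-refl
    (lift (perm ρ (↭-trans (prep _ π) (swap _ _ ↭-refl)) ↭-refl d))

contradictory : (w ∶ var p) ∈ Γ → (w ∶ ¬' (var p)) ∈ Γ → Der full (R ∣ Γ ⇒ Δ)
contradictory m n = ¬l-∈ n (id*-∈ m)

Reach : List RelAtom → Label → Label → Set
Reach R = Star (λ a b → (a ≤' b) ∈ R)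

lift-along : Reach R a b → (a ∶ A) ∈ Γ →
             (∀ {Θ} → Γ ⊆ Θ → (b ∶ A) ∈ Θ → Der full (R ∣ Θ ⇒ Δ)) → Der full (R ∣ Γ ⇒ Δ)
lift-along ε m k = k (λ n → n) m
lift-along (e ◅ r) m k = lift-∈ e m (lift-along r (here refl) λ s → k (s ∘ there))

-- (∧l) and (∨l) consume their principal formula, yet several source formulas may be
-- sent to the same target formula (e.g. after (lift) along a loop w ≤ w); those keep
-- being covered by its components.
data Covers (Γ : List LFormula) : LFormula → Set where
  member : x ∈ Γ → Covers Γ x
  both   : Covers Γ (w ∶ A) → Covers Γ (w ∶ B) → Covers Γ (w ∶ A ∧ B)
  left   : Covers Γ (w ∶ A) → Covers Γ (w ∶ A ∨ B)
  right  : Covers Γ (w ∶ B) → Covers Γ (w ∶ A ∨ B)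

Covers-bind : All (Covers Θ) Γ → Covers Γ x → Covers Θ x
Covers-bind k (member m) = All.lookup k m
Covers-bind k (both c d) = both (Covers-bind k c) (Covers-bind k d)
Covers-bind k (left c)   = left (Covers-bind k c)
Covers-bind k (right c)  = right (Covers-bind k c)

Covers-mono : Γ ⊆ Θ → Covers Γ x → Covers Θ x
Covers-mono s = Covers-bind (All.tabulate (member ∘ s))

var-Covers⇒∈ : Covers Γ (w ∶ var p) → (w ∶ var p) ∈ Γ
var-Covers⇒∈ (member m) = m

¬-Covers⇒∈ : Covers Γ (w ∶ ¬' A) → (w ∶ ¬' A) ∈ Γ
¬-Covers⇒∈ (member m) = m

⊃-Covers⇒∈ : Covers Γ (w ∶ A ⊃ B) → (w ∶ A ⊃ B) ∈ Γ
⊃-Covers⇒∈ (member m) = m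

covered-by-parts : Γ ↭ x ∷ G → Covers Θ x → G ⊆ Θ → All (Covers Θ) Γ
covered-by-parts π c s = All-resp-↭ (↭-sym π) (c ∷ All.tabulate (member ∘ s))

split-∧ : Covers Γ (w ∶ A ∧ B) →
          (∀ {Θ} → All (Covers Θ) Γ → Covers Θ (w ∶ A) → Covers Θ (w ∶ B) → Der full (R ∣ Θ ⇒ Δ)) →
          Der full (R ∣ Γ ⇒ Δ)
split-∧ (member m) k with _ , π ← ∈⇒↭∷ m =
  ↭-ant (↭-sym π) (∧l (k (covered-by-parts π (both cA cB) (there ∘ there)) cA cB))
  where
  cA = member (here refl)
  cB = member (there (here refl))
split-∧ (both c d) k = k (All.tabulate member) c d

split-∨ : Covers Γ (w ∶ A ∨ B) →
          (∀ {Θ} → All (Covers Θ) Γ → Covers Θ (w ∶ A) → Der full (R ∣ Θ ⇒ Δ)) →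
          (∀ {Θ} → All (Covers Θ) Γ → Covers Θ (w ∶ B) → Der full (R ∣ Θ ⇒ Δ)) →
          Der full (R ∣ Γ ⇒ Δ)
split-∨ (member m) k l with _ , π ← ∈⇒↭∷ m =
  ↭-ant (↭-sym π) (∨l (k (covered-by-parts π (left cA) there) cA) (l (covered-by-parts π (right cB) there) cB))
  where
  cA = member (here refl)
  cB = member (here refl)
split-∨ (left c) k l = k (All.tabulate member) c
split-∨ (right c) k l = l (All.tabulate member) c

⊥-covered : Covers Γ (w ∶ ⊥') → Der full (R ∣ Γ ⇒ Δ)
⊥-covered c = split-∧ c λ _ c₀ c₁ → contradictory (var-Covers⇒∈ c₀) (¬-Covers⇒∈ c₁)

lift-covered : Reach R a b → Covers Γ (a ∶ A) →
               (∀ {Θ} → Γ ⊆ Θ → Covers Θ (b ∶ A) → Der full (R ∣ Θ ⇒ Δ)) → Der full (R ∣ Γ ⇒ Δ)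
lift-covered r (member m) k = lift-along r m λ s → k s ∘ member
lift-covered r (both c d) k =
  lift-covered r c λ s c' → lift-covered r (Covers-mono s d) λ s' d' →
    k (s' ∘ s) (both (Covers-mono s' c') d')
lift-covered r (left c)  k = lift-covered r c λ s → k s ∘ left
lift-covered r (right c) k = lift-covered r c λ s → k s ∘ right

rename : (Label → Label) → LFormula → LFormula
rename f x = f (LFormula.lab x) ∶ LFormula.fml x

Preserved : (Label → Label) → List RelAtom → RelAtom → Set
Preserved f R x = Reach R (f (RelAtom.src x)) (f (RelAtom.tgt x))

record Weakening (f : Label → Label) (S S' : Sequent) : Set where
  constructor weakening
  field
    reach   : All (Preserved f (Sequent.rel S')) (Sequent.rel S)
    cover   : All (Covers (Sequent.ant S') ∘ rename f) (Sequent.ant S)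
    extra   : List LFormula
    shuffle : Sequent.suc S' ↭ map (rename f) (Sequent.suc S) ++ extra
open Weakening

Robust : Sequent → Set
Robust S = ∀ f S' → Weakening f S S' → Der𝒞⁻ S'

Weakening-refl : Weakening (λ n → n) S S
Weakening-refl {R ∣ Γ ⇒ Δ} =
  weakening (All.tabulate (_◅ ε)) (All.tabulate member) []
    (↭-reflexive (sym (trans (++-identityʳ _) (map-id Δ))))

Weakening-resp-↭ : R ↭ R' → Γ ↭ Γ' → Δ ↭ Δ' →
                   Weakening f (R' ∣ Γ' ⇒ Δ') S → Weakening f (R ∣ Γ ⇒ Δ) S
Weakening-resp-↭ {f = f} ρ π τ (weakening r c F δ) =
  weakening (All-resp-↭ (↭-sym ρ) r) (All-resp-↭ (↭-sym π) c) F
    (↭-trans δ (++⁺ʳ F (map⁺ (rename f) (↭-sym τ))))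

Robust-resp-↭ : R ↭ R' → Γ ↭ Γ' → Δ ↭ Δ' → Robust (R ∣ Γ ⇒ Δ) → Robust (R' ∣ Γ' ⇒ Δ')
Robust-resp-↭ ρ π τ t f S σ = t f S (Weakening-resp-↭ ρ π τ σ)

∷-rel : Preserved f R' α → Weakening f (R ∣ Γ ⇒ Δ) (R' ∣ Γ' ⇒ Δ') →
        Weakening f (α ∷ R ∣ Γ ⇒ Δ) (R' ∣ Γ' ⇒ Δ')
∷-rel r (weakening rs c F δ) = weakening (r ∷ rs) c F δ

weaken-rel : R' ⊆ R'' → Weakening f (R ∣ Γ ⇒ Δ) (R' ∣ Γ' ⇒ Δ') →
             Weakening f (R ∣ Γ ⇒ Δ) (R'' ∣ Γ' ⇒ Δ')
weaken-rel s (weakening r c F δ) = weakening (All.map (Star.map s) r) c F δ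

∷-ant : Covers Θ (rename f x) → Weakening f (R ∣ Γ ⇒ Δ) (R' ∣ Θ ⇒ Δ') →
        Weakening f (R ∣ x ∷ Γ ⇒ Δ) (R' ∣ Θ ⇒ Δ')
∷-ant c (weakening r cs F δ) = weakening r (c ∷ cs) F δ

tail-ant : Weakening f (R ∣ x ∷ Γ ⇒ Δ) S → Weakening f (R ∣ Γ ⇒ Δ) S
tail-ant (weakening r (_ ∷ cs) F δ) = weakening r cs F δ

rebase-ant : All (Covers Θ) Γ' → Weakening f (R ∣ Γ ⇒ Δ) (R' ∣ Γ' ⇒ Δ') →
             Weakening f (R ∣ Γ ⇒ Δ) (R' ∣ Θ ⇒ Δ')
rebase-ant k (weakening r c F δ) = weakening r (All.map (Covers-bind k) c) F δ

weaken-ant : Γ' ⊆ Θ → Weakening f (R ∣ Γ ⇒ Δ) (R' ∣ Γ' ⇒ Δ') →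
             Weakening f (R ∣ Γ ⇒ Δ) (R' ∣ Θ ⇒ Δ')
weaken-ant s = rebase-ant (All.tabulate (member ∘ s))

∷-suc : y' ≡ rename f y → Weakening f (R ∣ Γ ⇒ Δ) (R' ∣ Γ' ⇒ Δ') →
        Weakening f (R ∣ Γ ⇒ y ∷ Δ) (R' ∣ Γ' ⇒ y' ∷ Δ')
∷-suc e (weakening r c F δ) = weakening r c F (↭-trans (prep _ δ) (↭-reflexive (cong (_∷ _) e)))

sideʳ : Weakening f (R ∣ Γ ⇒ y ∷ Δ) S → List LFormula
sideʳ {f = f} {Δ = Δ} σ = map (rename f) Δ ++ extra σ

tail-suc : (σ : Weakening f (R ∣ Γ ⇒ y ∷ Δ) (R' ∣ Γ' ⇒ Δ')) →
           Weakening f (R ∣ Γ ⇒ Δ) (R' ∣ Γ' ⇒ sideʳ σ)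
tail-suc (weakening r c F _) = weakening r c F ↭-refl

head-suc : (σ : Weakening f (R ∣ Γ ⇒ y ∷ Δ) (R' ∣ Γ' ⇒ Δ')) →
           Der𝒞⁻ (R' ∣ Γ' ⇒ rename f y ∷ sideʳ σ) → Der𝒞⁻ (R' ∣ Γ' ⇒ Δ')
head-suc σ = ↭-suc (↭-sym (shuffle σ))

freshLabel : Sequent → Label
freshLabel S = suc (max 0 (labels S))

freshLabel-fresh : ∀ S → Fresh (freshLabel S) S
freshLabel-fresh S m = 1+n≰n (All.lookup (xs≤max 0 (labels S)) m)

_[_↦_] : (Label → Label) → Label → Label → Label → Label
(f [ v ↦ v' ]) x with v ≟ x
... | yes _ = v'
... | no  _ = f x

update-≡ : ∀ f v v' → (f [ v ↦ v' ]) v ≡ v'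
update-≡ f v v' with v ≟ v
... | yes _   = refl
... | no  v≢v = contradiction refl v≢v

update-≢ : v ≢ a → (f [ v ↦ v' ]) a ≡ f a
update-≢ {v} {a} v≢a with v ≟ a
... | yes v≡a = contradiction v≡a v≢a
... | no  _   = refl

eigenvariable-distinct : Fresh v (R ∣ Γ ⇒ (w ∶ C) ∷ Δ) → v ≢ w × All (v ≢_) (labels (R ∣ Γ ⇒ Δ))
eigenvariable-distinct {R = R} {Γ = Γ} fr
  with ∉R , ∉Γw ← ++⁻ (labelsR R) (¬Any⇒All¬ _ fr)
  with ∉Γ , v≢w ∷ ∉Δ ← ++⁻ (labelsF Γ) ∉Γw
  = v≢w , ++⁺ ∉R (++⁺ ∉Γ ∉Δ)

relabel : All (λ a → g a ≡ f a) (labels (R ∣ Γ ⇒ Δ)) →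
          Weakening f (R ∣ Γ ⇒ Δ) S → Weakening g (R ∣ Γ ⇒ Δ) S
relabel {R = R} {Γ = Γ} eqs (weakening r c F δ)
  with eqR , eqΓΔ ← ++⁻ (labelsR R) eqs
  with eqΓ , eqΔ ← ++⁻ (labelsF Γ) eqΓΔ
  = weakening
      (All.zipWith (λ { (ea ∷ eb ∷ [] , rab) → subst₂ (Reach _) (sym ea) (sym eb) rab })
                   (map⁻ (concat⁻ eqR) , r))
      (All.zipWith (λ { (ea ∷ [] , ca) → subst (λ a → Covers _ (a ∶ _)) (sym ea) ca })
                   (map⁻ (concat⁻ eqΓ) , c))
      F
      (↭-trans δ (↭-reflexive (cong (_++ F) (map-cong-local
        (All.map (λ { (ea ∷ []) → cong (_∶ _) (sym ea) }) (map⁻ (concat⁻ eqΔ)))))))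

eigenvariable-weakening : Fresh v (R ∣ Γ ⇒ (w ∶ C) ∷ Δ) →
  Weakening f (R ∣ Γ ⇒ Δ) (R' ∣ Γ' ⇒ Δ') →
  Weakening (f [ v ↦ v' ]) ((w ≤' v) ∷ R ∣ (v ∶ A) ∷ Γ ⇒ Δ) ((f w ≤' v') ∷ R' ∣ (v' ∶ A) ∷ Γ' ⇒ Δ')
eigenvariable-weakening {v} {R} {Γ} {C = C} {Δ} {f} {v' = v'} fr σ
  with v≢w , ∉S ← eigenvariable-distinct {R = R} {Γ} {C = C} {Δ} fr =
  ∷-rel (subst₂ (Reach _) (sym (update-≢ v≢w)) (sym (update-≡ f v v')) (here refl ◅ ε))
    (∷-ant (subst (λ a → Covers _ (a ∶ _)) (sym (update-≡ f v v')) (member (here refl)))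
      (weaken-ant there (weaken-rel there (relabel (All.map update-≢ ∉S) σ))))

robust-∧l : Robust (R ∣ (w ∶ A) ∷ (w ∶ B) ∷ Γ ⇒ Δ) → Robust (R ∣ (w ∶ A ∧ B) ∷ Γ ⇒ Δ)
robust-∧l t f (R' ∣ Γ' ⇒ Δ') σ =
  split-∧ (All.head (cover σ)) λ k cA cB → t f _ (∷-ant cA (∷-ant cB (rebase-ant k (tail-ant σ))))

robust-∨l : Robust (R ∣ (w ∶ A) ∷ Γ ⇒ Δ) → Robust (R ∣ (w ∶ B) ∷ Γ ⇒ Δ) →
            Robust (R ∣ (w ∶ A ∨ B) ∷ Γ ⇒ Δ)
robust-∨l t₁ t₂ f (R' ∣ Γ' ⇒ Δ') σ =
  split-∨ (All.head (cover σ))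
    (λ k cA → t₁ f _ (∷-ant cA (rebase-ant k (tail-ant σ))))
    (λ k cB → t₂ f _ (∷-ant cB (rebase-ant k (tail-ant σ))))

apply-⊃*l : Weakening f (R ∣ (w ∶ A ⊃ B) ∷ Γ ⇒ Δ) (R' ∣ Θ ⇒ Δ') → (f u ∶ A ⊃ B) ∈ Θ →
            Robust (R ∣ (w ∶ A ⊃ B) ∷ Γ ⇒ (u ∶ A) ∷ Δ) →
            Robust (R ∣ (w ∶ A ⊃ B) ∷ (u ∶ B) ∷ Γ ⇒ Δ) → Der𝒞⁻ (R' ∣ Θ ⇒ Δ')
apply-⊃*l {f = f} σ m t₁ t₂ =
  ⊃*l-∈ m (t₁ f _ (∷-suc refl σ))
    (Robust-resp-↭ ↭-refl (swap _ _ ↭-refl) ↭-refl t₂ f _ (∷-ant (member (here refl)) (weaken-ant there σ)))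

robust-⊃l : Robust ((w ≤' v) ∷ R ∣ (w ∶ A ⊃ B) ∷ Γ ⇒ (v ∶ A) ∷ Δ) →
            Robust ((w ≤' v) ∷ R ∣ (w ∶ A ⊃ B) ∷ (v ∶ B) ∷ Γ ⇒ Δ) →
            Robust ((w ≤' v) ∷ R ∣ (w ∶ A ⊃ B) ∷ Γ ⇒ Δ)
robust-⊃l t₁ t₂ f (R' ∣ Γ' ⇒ Δ') σ =
  lift-along (All.head (reach σ)) (⊃-Covers⇒∈ (All.head (cover σ))) λ s m →
    apply-⊃*l (weaken-ant s σ) m t₁ t₂

robust-lift : Robust ((w ≤' u) ∷ R ∣ (w ∶ A) ∷ (u ∶ A) ∷ Γ ⇒ Δ) →
              Robust ((w ≤' u) ∷ R ∣ (w ∶ A) ∷ Γ ⇒ Δ)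
robust-lift t f (R' ∣ Γ' ⇒ Δ') σ =
  lift-covered (All.head (reach σ)) (All.head (cover σ)) λ s c →
    Robust-resp-↭ ↭-refl (swap _ _ ↭-refl) ↭-refl t f _ (∷-ant c (weaken-ant s σ))

robust-tra : Robust ((w ≤' v) ∷ (v ≤' u) ∷ (w ≤' u) ∷ R ∣ Γ ⇒ Δ) →
             Robust ((w ≤' v) ∷ (v ≤' u) ∷ R ∣ Γ ⇒ Δ)
robust-tra t f S (weakening (r₁ ∷ r₂ ∷ rs) c F δ) =
  t f S (weakening (r₁ ∷ r₂ ∷ (r₁ ◅◅ r₂) ∷ rs) c F δ)

robust-⊃r : Fresh v (R ∣ Γ ⇒ (w ∶ A ⊃ B) ∷ Δ) →
            Robust ((w ≤' v) ∷ R ∣ (v ∶ A) ∷ Γ ⇒ (v ∶ B) ∷ Δ) → Robust (R ∣ Γ ⇒ (w ∶ A ⊃ B) ∷ Δ)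
robust-⊃r {v} {w = w} {A} {B} fr t f (R' ∣ Γ' ⇒ Δ') σ =
  head-suc σ (⊃r (freshLabel-fresh S₀)
    (t _ _ (∷-suc (cong (_∶ B) (sym (update-≡ f v (freshLabel S₀))))
                  (eigenvariable-weakening {C = A ⊃ B} fr (tail-suc σ)))))
  where
  S₀ = R' ∣ Γ' ⇒ (f w ∶ A ⊃ B) ∷ sideʳ σ

robust-¬r : Fresh v (R ∣ Γ ⇒ (w ∶ ¬' A) ∷ Δ) →
            Robust ((w ≤' v) ∷ R ∣ (v ∶ A) ∷ Γ ⇒ Δ) → Robust (R ∣ Γ ⇒ (w ∶ ¬' A) ∷ Δ)
robust-¬r {w = w} {A} fr t f (R' ∣ Γ' ⇒ Δ') σ =
  head-suc σ (¬r (freshLabel-fresh S₀) (t _ _ (eigenvariable-weakening {C = ¬' A} fr (tail-suc σ))))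
  where
  S₀ = R' ∣ Γ' ⇒ (f w ∶ ¬' A) ∷ sideʳ σ

robust : Der𝒞 S → Robust S
robust (perm ρ π τ d) = Robust-resp-↭ ρ π τ (robust d)
robust (id _) f (R' ∣ Γ' ⇒ Δ') σ =
  lift-along (All.head (reach σ)) (var-Covers⇒∈ (All.head (cover σ))) λ s m → head-suc (weaken-ant s σ) (id*-∈ m)
robust (⊥l _) f (R' ∣ Γ' ⇒ Δ') σ = ⊥-covered (All.head (cover σ))
robust (∧l d) = robust-∧l (robust d)
robust (∧r d e) f (R' ∣ Γ' ⇒ Δ') σ =
  head-suc σ (∧r (robust d f _ (∷-suc refl (tail-suc σ))) (robust e f _ (∷-suc refl (tail-suc σ))))
robust (∨l d e) = robust-∨l (robust d) (robust e)
robust (∨r d) f (R' ∣ Γ' ⇒ Δ') σ =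
  head-suc σ (∨r (robust d f _ (∷-suc refl (∷-suc refl (tail-suc σ)))))
robust (⊃r fr d) = robust-⊃r fr (robust d)
robust (⊃l _ d e) = robust-⊃l (robust d) (robust e)
robust (ref _ d) f S σ = robust d f S (∷-rel ε σ)
robust (tra _ d) = robust-tra (robust d)
robust id* f (R' ∣ Γ' ⇒ Δ') σ = head-suc σ (id*-∈ (var-Covers⇒∈ (All.head (cover σ))))
robust (¬r fr d) = robust-¬r fr (robust d)
robust (¬l d) f (R' ∣ Γ' ⇒ Δ') σ =
  ¬l-∈ (¬-Covers⇒∈ (All.head (cover σ))) (robust d f _ (∷-suc refl σ))
robust (⊃*l d e) f (R' ∣ Γ' ⇒ Δ') σ =
  apply-⊃*l σ (⊃-Covers⇒∈ (All.head (cover σ))) (robust d) (robust e)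
robust (lift d) = robust-lift (robust d)

theorem3 : (S : Sequent) → Der𝒞 S → Der𝒞⁻ S
theorem3 S d = robust d (λ n → n) S Weakening-refl
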